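{- Let $\mathbb{M}$ be the set of multiplicative functions and let $W:(\mathbb{N}^{\star})^2\to\mathbb{C}$ be any function. Define, for $F,G\in\mathbb{M}$ and $m\in\mathbb{N}^{\star}$, $(F\,\square\,G)(m)=\sum_{ab=m}F(a)G(b)W(a,b)$. Then \[ \big(\forall F,G\in\mathbb{M},\ \forall m\in\mathbb{N}^{\star}:\ (F\,\square\,G)(m)=(G\,\square\,F)(m)\big)\iff\big(\forall a,b\in\mathbb{N}^{\star}:\ W(a,b)=W(b,a)\big). \]
   Context: $\mathbb{M}$ is the set of functions $F:\mathbb{N}^{\star}\to\mathbb{C}$ with $F(1)=1$ and $F(ab)=F(a)F(b)$ whenever $\gcd(a,b)=1$. The sum $\sum_{ab=m}$ runs over ordered pairs $(a,b)$ of positive integers with $ab=m$. -}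

module Defs where

open import Level using (Level)
open import Data.Nat using (ℕ; zero; suc; _/_; _<_) renaming (_*_ to _*ℕ_)
open import Data.Nat.Divisibility using (_∣_; _∣?_)
open import Data.Nat.Coprimality using (Coprime)
open import Data.Product using (_×_)
open import Relation.Nullary using (yes; no)
open import Algebra.Bundles using (CommutativeRing)

module _ {c ℓ : Level} (R : CommutativeRing c ℓ) where
  open CommutativeRing R

  -- Multiplicative function N* → R (the value at 0 is irrelevant and unconstrained):
  -- F(1) = 1 and F(ab) = F(a)F(b) whenever a, b ≥ 1 are coprime.
  IsMultiplicative : (ℕ → Carrier) → Set ℓ
  IsMultiplicative F =
    (F 1 ≈ 1#) ×
    (∀ a b → 0 < a → 0 < b → Coprime a b → F (a *ℕ b) ≈ F a * F b)

  divSumUpTo : (ℕ → ℕ → Carrier) → ℕ → ℕ → Carrier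
  divSumUpTo t m zero = 0#
  divSumUpTo t m (suc k) with suc k ∣? m
  ... | yes _ = t (suc k) (m / suc k) + divSumUpTo t m k
  ... | no  _ = divSumUpTo t m k

  -- Σ_{ab = m} t a b  (ordered pairs of positive integers), for m ≥ 1
  sumPairs : (ℕ → ℕ → Carrier) → ℕ → Carrier
  sumPairs t m = divSumUpTo t m m

  box : (W : ℕ → ℕ → Carrier) → (F G : ℕ → Carrier) → ℕ → Carrier
  box W F G m = sumPairs (λ a b → (F a * G b) * W a b) m

-- If W is symmetric, the substitution (a, b) ↦ (b, a) turns the sum defining (F □ G)(m)
-- into the one defining (G □ F)(m). Conversely, let 1[· ∣ a] be the indicator of the
-- divisors of a, a multiplicative function. In (1[· ∣ a] □ 1[· ∣ b])(ab) only the pair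
-- (a, b) survives, since i ∣ a, j ∣ b and ij = ab force i = a, j = b; so this value is
-- W(a, b), and commutativity gives W(a, b) = W(b, a).
module Submission where

open import Defs
open import Level using (Level; _⊔_)
open import Data.Nat using (ℕ; zero; suc; _<_; _≤_; z≤n; s≤s; _/_; _≟_)
  renaming (_*_ to _*ℕ_)
import Data.Nat.Properties as ℕₚ
open import Data.Nat.Divisibility
  using (_∣_; _∣?_; ∣⇒≤; ∣-refl; 1∣_; n∣m*n; m∣m*n; ∣-trans; divides; n/m≡quotient)
open import Data.Nat.Coprimality using (Coprime; coprime⇒gcd≡1)
open import Data.Nat.GCD using (gcd)
open import Data.Nat.LCM using (lcm; gcd*lcm; lcm-least)
open import Data.Product using (_,_)
open import Data.Empty using (⊥-elim)
open import Function.Bundles using (_⇔_; mk⇔)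
open import Relation.Nullary using (yes; no; ¬_)
open import Relation.Binary.PropositionalEquality as ≡
  using (_≡_; _≢_; cong; subst; module ≡-Reasoning)
open import Algebra.Bundles using (CommutativeRing)

coprime⇒lcm≡* : ∀ {m n} → Coprime m n → lcm m n ≡ m *ℕ n
coprime⇒lcm≡* {m} {n} c = begin
  lcm m n             ≡⟨ ≡.sym (ℕₚ.*-identityˡ (lcm m n)) ⟩
  1 *ℕ lcm m n        ≡⟨ cong (_*ℕ lcm m n) (≡.sym (coprime⇒gcd≡1 c)) ⟩
  gcd m n *ℕ lcm m n  ≡⟨ gcd*lcm m n ⟩
  m *ℕ n              ∎
  where open ≡-Reasoning

coprime-∣-∣⇒*∣ : ∀ {m n k} → Coprime m n → m ∣ k → n ∣ k → m *ℕ n ∣ k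
coprime-∣-∣⇒*∣ c m∣k n∣k = subst (_∣ _) (coprime⇒lcm≡* c) (lcm-least m∣k n∣k)

-- If i < a then i j ≤ i b < a b.
∣-∣-*≡*⇒≡ : ∀ {i j a b} → 0 < a → 0 < b → i ∣ a → j ∣ b → i *ℕ j ≡ a *ℕ b → i ≡ a
∣-∣-*≡*⇒≡ {i} {j} {a@(suc _)} {b@(suc _)} _ _ i∣a j∣b ij≡ab =
  ℕₚ.≤-antisym (∣⇒≤ i∣a) (ℕₚ.≮⇒≥ λ i<a →
    ℕₚ.<-irrefl ij≡ab (ℕₚ.≤-<-trans (ℕₚ.*-monoʳ-≤ i (∣⇒≤ j∣b)) (ℕₚ.*-monoˡ-< b i<a)))

module _ {c ℓ : Level} (R : CommutativeRing c ℓ) where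
  open CommutativeRing R
  open import Relation.Binary.Reasoning.Setoid setoid
  open import Algebra.Properties.CommutativeSemigroup +-commutativeSemigroup using (interchange)

  sumTo : (ℕ → Carrier) → ℕ → Carrier
  sumTo f zero    = 0#
  sumTo f (suc k) = f (suc k) + sumTo f k

  sumTo-cong : ∀ {f g} k → (∀ i → 0 < i → i ≤ k → f i ≈ g i) → sumTo f k ≈ sumTo g k
  sumTo-cong zero    f≈g = refl
  sumTo-cong (suc k) f≈g =
    +-cong (f≈g (suc k) (s≤s z≤n) ℕₚ.≤-refl) (sumTo-cong k λ i 0<i i≤k → f≈g i 0<i (ℕₚ.m≤n⇒m≤1+n i≤k))

  sumTo-zero : ∀ {f} k → (∀ i → 0 < i → i ≤ k → f i ≈ 0#) → sumTo f k ≈ 0#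
  sumTo-zero k f≈0 = trans (sumTo-cong k f≈0) (sumTo-const-0 k)
    where
    sumTo-const-0 : ∀ k → sumTo (λ _ → 0#) k ≈ 0#
    sumTo-const-0 zero    = refl
    sumTo-const-0 (suc k) = trans (+-identityˡ _) (sumTo-const-0 k)

  sumTo-+ : ∀ f g k → sumTo (λ i → f i + g i) k ≈ sumTo f k + sumTo g k
  sumTo-+ f g zero    = sym (+-identityˡ 0#)
  sumTo-+ f g (suc k) =
    trans (+-cong refl (sumTo-+ f g k)) (interchange (f (suc k)) (g (suc k)) (sumTo f k) (sumTo g k))

  sumTo-comm : ∀ (h : ℕ → ℕ → Carrier) k n →
               sumTo (λ i → sumTo (h i) n) k ≈ sumTo (λ j → sumTo (λ i → h i j) k) n
  sumTo-comm h zero    n = sym (sumTo-zero n λ _ _ _ → refl)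
  sumTo-comm h (suc k) n = begin
    sumTo (h (suc k)) n + sumTo (λ i → sumTo (h i) n) k
      ≈⟨ +-cong refl (sumTo-comm h k n) ⟩
    sumTo (h (suc k)) n + sumTo (λ j → sumTo (λ i → h i j) k) n
      ≈⟨ sym (sumTo-+ (h (suc k)) (λ j → sumTo (λ i → h i j) k) n) ⟩
    sumTo (λ j → h (suc k) j + sumTo (λ i → h i j) k) n
      ∎

  sumTo-single : ∀ {f} k a → 0 < a → a ≤ k →
                 (∀ i → 0 < i → i ≤ k → i ≢ a → f i ≈ 0#) → sumTo f k ≈ f a
  sumTo-single zero    a 0<a a≤0 _ = ⊥-elim (ℕₚ.<-irrefl ≡.refl (ℕₚ.<-≤-trans 0<a a≤0))
  sumTo-single {f} (suc k) a 0<a a≤k f≈0 with suc k ≟ a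
  ... | yes ≡.refl = trans (+-cong refl (sumTo-zero k λ i 0<i i≤k →
                     f≈0 i 0<i (ℕₚ.m≤n⇒m≤1+n i≤k) λ { ≡.refl → ℕₚ.<-irrefl ≡.refl i≤k })) (+-identityʳ _)
  ... | no  k≢a  = trans (+-cong (f≈0 (suc k) (s≤s z≤n) ℕₚ.≤-refl k≢a) rest) (+-identityˡ _)
    where
    rest : sumTo _ k ≈ f a
    rest = sumTo-single k a 0<a (ℕₚ.≤-pred (ℕₚ.≤∧≢⇒< a≤k λ a≡k → k≢a (≡.sym a≡k)))
             λ i 0<i i≤k → f≈0 i 0<i (ℕₚ.m≤n⇒m≤1+n i≤k)

  onHyperbola : (ℕ → ℕ → Carrier) → ℕ → ℕ → ℕ → Carrier
  onHyperbola t m i j with i *ℕ j ≟ m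
  ... | yes _ = t i j
  ... | no  _ = 0#

  onHyperbola-on : ∀ t {m i j} → i *ℕ j ≡ m → onHyperbola t m i j ≈ t i j
  onHyperbola-on t {m} {i} {j} ij≡m with i *ℕ j ≟ m
  ... | yes _    = refl
  ... | no ij≢m = ⊥-elim (ij≢m ij≡m)

  onHyperbola-off : ∀ t {m i j} → i *ℕ j ≢ m → onHyperbola t m i j ≈ 0#
  onHyperbola-off t {m} {i} {j} ij≢m with i *ℕ j ≟ m
  ... | yes ij≡m = ⊥-elim (ij≢m ij≡m)
  ... | no _     = refl

  onHyperbola-transpose : ∀ t s m → (∀ a b → 0 < a → 0 < b → t a b ≈ s b a) →
                          ∀ i j → 0 < i → 0 < j → onHyperbola t m i j ≈ onHyperbola s m j i
  onHyperbola-transpose t s m t≈sᵀ i j 0<i 0<j with i *ℕ j ≟ m | j *ℕ i ≟ m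
  ... | yes _    | yes _    = t≈sᵀ i j 0<i 0<j
  ... | yes ij≡m | no ji≢m  = ⊥-elim (ji≢m (≡.trans (ℕₚ.*-comm j i) ij≡m))
  ... | no ij≢m  | yes ji≡m = ⊥-elim (ij≢m (≡.trans (ℕₚ.*-comm i j) ji≡m))
  ... | no _     | no _     = refl

  row-divisor : ∀ t {m i q} → 0 < i → i *ℕ q ≡ m → 0 < m →
                sumTo (onHyperbola t m i) m ≈ t i q
  row-divisor t {m} {i} {q} 0<i@(s≤s _) iq≡m 0<m =
    trans (sumTo-single m q 0<q q≤m λ j _ _ j≢q →
             onHyperbola-off t {m} {i} {j} λ ij≡m → j≢q (ℕₚ.*-cancelˡ-≡ j q i (≡.trans ij≡m (≡.sym iq≡m))))
          (onHyperbola-on t iq≡m)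
    where
    0<q : 0 < q
    0<q = ℕₚ.n≢0⇒n>0 λ { ≡.refl → ℕₚ.<-irrefl (≡.trans (≡.sym (ℕₚ.*-zeroʳ i)) iq≡m) 0<m }
    q≤m : q ≤ m
    q≤m = subst (q ≤_) iq≡m (ℕₚ.m≤n*m q i)

  row-nondivisor : ∀ t {m i} → ¬ i ∣ m → sumTo (onHyperbola t m i) m ≈ 0#
  row-nondivisor t {m} {i} i∤m = sumTo-zero m λ j _ _ →
    onHyperbola-off t {m} {i} {j} λ ij≡m → i∤m (divides j (≡.trans (≡.sym ij≡m) (ℕₚ.*-comm i j)))

  -- Spreading the divisor sum over the square [1, m]² turns the substitution (a, b) ↦ (b, a)
  -- into an interchange of summation.
  gridSum : (ℕ → ℕ → Carrier) → ℕ → ℕ → Carrier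
  gridSum t m k = sumTo (λ i → sumTo (onHyperbola t m i) m) k

  divSumUpTo≈gridSum : ∀ t m k → 0 < m → divSumUpTo R t m k ≈ gridSum t m k
  divSumUpTo≈gridSum t m zero    0<m = refl
  divSumUpTo≈gridSum t m (suc k) 0<m with suc k ∣? m
  ... | yes k+1∣m@(divides q m≡qk) = +-cong (sym row) (divSumUpTo≈gridSum t m k 0<m)
    where
    row : sumTo (onHyperbola t m (suc k)) m ≈ t (suc k) (m / suc k)
    row = trans (row-divisor t (s≤s z≤n) (≡.trans (ℕₚ.*-comm (suc k) q) (≡.sym m≡qk)) 0<m)
                (reflexive (cong (t (suc k)) (≡.sym (n/m≡quotient k+1∣m))))
  ... | no k+1∤m = trans (divSumUpTo≈gridSum t m k 0<m)
                     (sym (trans (+-cong (row-nondivisor t k+1∤m) refl) (+-identityˡ _)))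

  sumPairs≈gridSum : ∀ t m → 0 < m → sumPairs R t m ≈ gridSum t m m
  sumPairs≈gridSum t m = divSumUpTo≈gridSum t m m

  sumPairs-transpose : ∀ t s m → 0 < m → (∀ a b → 0 < a → 0 < b → t a b ≈ s b a) →
                       sumPairs R t m ≈ sumPairs R s m
  sumPairs-transpose t s m 0<m t≈sᵀ = begin
    sumPairs R t m
      ≈⟨ sumPairs≈gridSum t m 0<m ⟩
    gridSum t m m
      ≈⟨ sumTo-cong m (λ i 0<i _ → sumTo-cong m λ j 0<j _ →
           onHyperbola-transpose t s m t≈sᵀ i j 0<i 0<j) ⟩
    sumTo (λ i → sumTo (λ j → onHyperbola s m j i) m) m
      ≈⟨ sumTo-comm (λ i j → onHyperbola s m j i) m m ⟩
    gridSum s m m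
      ≈⟨ sym (sumPairs≈gridSum s m 0<m) ⟩
    sumPairs R s m
      ∎

  sumPairs-single : ∀ t a b → 0 < a → 0 < b →
                    (∀ i j → i *ℕ j ≡ a *ℕ b → i ≢ a → t i j ≈ 0#) → sumPairs R t (a *ℕ b) ≈ t a b
  sumPairs-single t a@(suc _) b@(suc _) 0<a _ t≈0 = begin
    sumPairs R t m                    ≈⟨ sumPairs≈gridSum t m (s≤s z≤n) ⟩
    gridSum t m m                     ≈⟨ sumTo-single m a 0<a (ℕₚ.m≤m*n a b) offRow ⟩
    sumTo (onHyperbola t m a) m       ≈⟨ row-divisor t 0<a ≡.refl (s≤s z≤n) ⟩
    t a b                             ∎
    where
    m = a *ℕ b
    offRow : ∀ i → 0 < i → i ≤ m → i ≢ a → sumTo (onHyperbola t m i) m ≈ 0#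
    offRow i _ _ i≢a = sumTo-zero m λ j _ _ → onHyperbola-vanishes j
      where
      onHyperbola-vanishes : ∀ j → onHyperbola t m i j ≈ 0#
      onHyperbola-vanishes j with i *ℕ j ≟ m
      ... | yes ij≡m = t≈0 i j ij≡m i≢a
      ... | no _     = refl

  divisorIndicator : ℕ → ℕ → Carrier
  divisorIndicator a n with n ∣? a
  ... | yes _ = 1#
  ... | no  _ = 0#

  divisorIndicator-self : ∀ a → divisorIndicator a a ≈ 1#
  divisorIndicator-self a with a ∣? a
  ... | yes _   = refl
  ... | no a∤a = ⊥-elim (a∤a ∣-refl)

  divisorIndicator-multiplicative : ∀ a → IsMultiplicative R (divisorIndicator a)
  divisorIndicator-multiplicative a = at1 , multiplicative
    where
    at1 : divisorIndicator a 1 ≈ 1#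
    at1 with 1 ∣? a
    ... | yes _   = refl
    ... | no 1∤a = ⊥-elim (1∤a (1∣ a))
    multiplicative : ∀ x y → 0 < x → 0 < y → Coprime x y →
      divisorIndicator a (x *ℕ y) ≈ divisorIndicator a x * divisorIndicator a y
    multiplicative x y _ _ coprime with x ∣? a | y ∣? a | x *ℕ y ∣? a
    ... | yes _   | yes _   | yes _    = sym (*-identityˡ 1#)
    ... | yes x∣a | yes y∣a | no xy∤a  = ⊥-elim (xy∤a (coprime-∣-∣⇒*∣ coprime x∣a y∣a))
    ... | no x∤a  | _       | yes xy∣a = ⊥-elim (x∤a (∣-trans (m∣m*n y) xy∣a))
    ... | yes _   | no y∤a  | yes xy∣a = ⊥-elim (y∤a (∣-trans (n∣m*n x) xy∣a))
    ... | no _    | _       | no _     = sym (zeroˡ _)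
    ... | yes _   | no _    | no _     = sym (zeroʳ _)

  box-divisorIndicator : ∀ W a b → 0 < a → 0 < b →
                         box R W (divisorIndicator a) (divisorIndicator b) (a *ℕ b) ≈ W a b
  box-divisorIndicator W a b 0<a 0<b = begin
    box R W 1[·∣a] 1[·∣b] (a *ℕ b)  ≈⟨ sumPairs-single u a b 0<a 0<b u≈0 ⟩
    (1[·∣a] a * 1[·∣b] b) * W a b  ≈⟨ *-cong (*-cong (divisorIndicator-self a) (divisorIndicator-self b)) refl ⟩
    (1# * 1#) * W a b              ≈⟨ trans (*-cong (*-identityˡ 1#) refl) (*-identityˡ _) ⟩
    W a b                          ∎
    where
    1[·∣a] = divisorIndicator a
    1[·∣b] = divisorIndicator b
    u : ℕ → ℕ → Carrier
    u i j = (1[·∣a] i * 1[·∣b] j) * W i j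
    u≈0 : ∀ i j → i *ℕ j ≡ a *ℕ b → i ≢ a → u i j ≈ 0#
    u≈0 i j ij≡ab i≢a with i ∣? a | j ∣? b
    ... | yes i∣a | yes j∣b = ⊥-elim (i≢a (∣-∣-*≡*⇒≡ 0<a 0<b i∣a j∣b ij≡ab))
    ... | no _    | _       = trans (*-cong (zeroˡ _) refl) (zeroˡ _)
    ... | yes _   | no _    = trans (*-cong (zeroʳ _) refl) (zeroˡ _)

  BoxCommutative : (ℕ → ℕ → Carrier) → Set (c ⊔ ℓ)
  BoxCommutative W = ∀ F G → IsMultiplicative R F → IsMultiplicative R G →
                     ∀ m → 0 < m → box R W F G m ≈ box R W G F m

  Symmetric : (ℕ → ℕ → Carrier) → Set ℓ
  Symmetric W = ∀ a b → 0 < a → 0 < b → W a b ≈ W b a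

  boxCommutative⇒symmetric : ∀ W → BoxCommutative W → Symmetric W
  boxCommutative⇒symmetric W □-comm a@(suc _) b@(suc _) 0<a 0<b = begin
    W a b                           ≈⟨ sym (box-divisorIndicator W a b 0<a 0<b) ⟩
    box R W 1[·∣a] 1[·∣b] (a *ℕ b)  ≈⟨ □-comm 1[·∣a] 1[·∣b] (divisorIndicator-multiplicative a)
                                         (divisorIndicator-multiplicative b) (a *ℕ b) (s≤s z≤n) ⟩
    box R W 1[·∣b] 1[·∣a] (a *ℕ b)  ≡⟨ cong (box R W 1[·∣b] 1[·∣a]) (ℕₚ.*-comm a b) ⟩
    box R W 1[·∣b] 1[·∣a] (b *ℕ a)  ≈⟨ box-divisorIndicator W b a 0<b 0<a ⟩
    W b a                           ∎
    where
    1[·∣a] = divisorIndicator a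
    1[·∣b] = divisorIndicator b

  symmetric⇒boxCommutative : ∀ W → Symmetric W → BoxCommutative W
  symmetric⇒boxCommutative W W-sym F G _ _ m 0<m =
    sumPairs-transpose _ _ m 0<m λ a b 0<a 0<b → *-cong (*-comm (F a) (G b)) (W-sym a b 0<a 0<b)

mainTheorem7 : {c ℓ : Level} (R : CommutativeRing c ℓ) → (W : ℕ → ℕ → CommutativeRing.Carrier R) →
    ((∀ (F G : ℕ → CommutativeRing.Carrier R) → IsMultiplicative R F → IsMultiplicative R G →
        ∀ m → 0 < m → CommutativeRing._≈_ R (box R W F G m) (box R W G F m))
    ⇔
     (∀ a b → 0 < a → 0 < b → CommutativeRing._≈_ R (W a b) (W b a)))
mainTheorem7 R W = mk⇔ (boxCommutative⇒symmetric R W) (symmetric⇒boxCommutative R W)
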